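{- If $G$ and $H$ are Left dead ends that are not integers, then (1) $\operatorname{flex}(G+\overline{n})=\operatorname{flex}(G)+n$ for every integer $n\geq0$; and (2) $\operatorname{flex}(G+H)=\max\{b(G)+\operatorname{flex}(H),\ \operatorname{flex}(G)+b(H)\}$.
   Context: All games are short partizan combinatorial game forms; $G+H$ is the disjunctive sum. A Left dead end is a game no subposition of which (including itself) has a Left option; its options are its Right options. Let $0=\{\cdot\mid\cdot\}$, $\overline{0}=0$ and $\overline{n}=\{\cdot\mid\overline{n-1}\}$ for $n\geq1$; a Left dead end is an integer if it is isomorphic to some $\overline{n}$. The flexibility is defined recursively by $\operatorname{flex}(G)=0$ if $G$ is an integer, and otherwise $\operatorname{flex}(G)=1+\max_{G'}\operatorname{flex}(G')$ over options $G'$ of $G$. $b(G)$ denotes the birthday of $G$; for a Left dead end it equals the height of its game tree (the maximum length of a sequence $G=G_0,G_1,\dots,G_k$ with each $G_{i+1}$ an option of $G_i$). -}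

module Defs where

open import Data.Nat using (ℕ; zero; suc; _⊔_; _≟_)
open import Data.List using (List; []; _∷_; _++_)
open import Data.Maybe using (Maybe; just; nothing)
open import Data.Bool using (Bool; true; false)
open import Relation.Nullary using (yes; no)

-- A Left dead end: a game form with no Left options at any subposition.
-- It is determined by its (finite list of) Right options, each again a Left dead end.
data LDE : Set where
  node : List LDE → LDE

opts : LDE → List LDE
opts (node gs) = gs

bar : ℕ → LDE
bar zero = node []
bar (suc n) = node (bar n ∷ [])

mutual
  _+ᴳ_ : LDE → LDE → LDE
  node gs +ᴳ node hs = node (sumL gs (node hs) ++ sumR (node gs) hs)

  sumL : List LDE → LDE → List LDE
  sumL [] h = []
  sumL (g ∷ gs) h = (g +ᴳ h) ∷ sumL gs h

  sumR : LDE → List LDE → List LDE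
  sumR g [] = []
  sumR g (h ∷ hs) = (g +ᴳ h) ∷ sumR g hs

infixl 6 _+ᴳ_

mutual
  iso : LDE → LDE → Bool
  iso (node gs) (node hs) = allAny gs hs Data.Bool.∧ allAny hs gs

  allAny : List LDE → List LDE → Bool
  allAny [] ys = true
  allAny (x ∷ xs) ys = anyIso x ys Data.Bool.∧ allAny xs ys

  anyIso : LDE → List LDE → Bool
  anyIso x [] = false
  anyIso x (y ∷ ys) = iso x y Data.Bool.∨ anyIso x ys

mutual
  b : LDE → ℕ
  b (node gs) = heightL gs

  heightL : List LDE → ℕ
  heightL [] = 0
  heightL (g ∷ gs) = suc (b g) ⊔ heightL gs

-- G is an integer iff G is isomorphic to some n̄.  Any such n equals the
-- height b(G) of G (n̄ has height n and isomorphism preserves height), so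
-- it suffices to test n = b(G); this makes the predicate decidable.
isInteger : LDE → Bool
isInteger g = iso g (bar (b g))

mutual
  flex : LDE → ℕ
  flex (node gs) with isInteger (node gs)
  ... | true = 0
  ... | false = suc (maxFlex gs)

  maxFlex : List LDE → ℕ
  maxFlex [] = 0
  maxFlex (g ∷ gs) = flex g ⊔ maxFlex gs

{-# OPTIONS --safe #-}
-- Upper bound: an option G′ + H has flex at most (b G′ + flex H) ⊔ (flex G′ + b H),
-- and b G′ < b G and flex G′ < flex G, so all options lie strictly below the claimed value;
-- an integer option G′ = n̄ is instead covered by the one-sided case flex (n̄ + H) = n + flex H,
-- proved by the same argument. Lower bound: pick an option G′ with b G′ + 1 = b G, then
-- flex (G + H) > flex (G′ + H) ≥ b G′ + flex H. As G + H is an integer exactly when both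
-- summands are, flex (G + H) = flex (H + G), so each one-sided bound also holds swapped.
module Submission where

open import Defs
open import Data.Nat using (ℕ; _+_; _⊔_)
open import Data.Bool using (false)
open import Data.Product using (_×_)
open import Relation.Binary.PropositionalEquality using (_≡_)
open import Data.Nat using (zero; suc; _≤_; _<_; z≤n; s≤s)
open import Data.Nat.Properties
open import Data.Bool using (true; _∧_)
open import Data.Bool.Properties using (∧-comm; ∧-conicalˡ; ∧-conicalʳ; ∧-zeroʳ; ∨-zeroʳ; ⇔→≡)
open import Data.Product using (_,_; proj₁; proj₂; ∃-syntax)
open import Data.Sum using (_⊎_; inj₁; inj₂)
open import Data.List using (List; []; _∷_; _++_; map)
open import Data.List.Relation.Unary.All as All using (All; []; _∷_)
open import Data.List.Relation.Unary.Any using (Any; here; there)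
import Data.List.Relation.Unary.All.Properties as Allₚ
open import Data.List.Membership.Propositional using (_∈_; find)
open import Data.List.Membership.Propositional.Properties using (∈-map⁺; ∈-++⁺ˡ; ∈-++⁺ʳ)
open import Function using (_∘_; _⇔_; mk⇔; Equivalence)
open import Relation.Binary.PropositionalEquality using (refl; sym; trans; cong; cong₂; subst)
open ≤-Reasoning

mutual
  LDE-ind : {P : LDE → Set} → (∀ G → (∀ {g} → g ∈ opts G → P g) → P G) → ∀ G → P G
  LDE-ind step (node gs) = step (node gs) (All.lookup (LDE-ind-all step gs))

  LDE-ind-all : {P : LDE → Set} → (∀ G → (∀ {g} → g ∈ opts G → P g) → P G) → ∀ gs → All P gs
  LDE-ind-all step [] = []
  LDE-ind-all step (g ∷ gs) = LDE-ind step g ∷ LDE-ind-all step gs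

IndStep₂ : (LDE → LDE → Set) → Set
IndStep₂ P = ∀ G H → (∀ {g} → g ∈ opts G → P g H) → (∀ {h} → h ∈ opts H → P G h) → P G H

LDE-ind₂ : {P : LDE → LDE → Set} → IndStep₂ P → ∀ G H → P G H
LDE-ind₂ {P} step = LDE-ind {λ G → ∀ H → P G H} λ G ih-G →
  LDE-ind {P G} λ H ih-H → step G H (λ g∈ → ih-G g∈ H) ih-H

module Maximum {f : LDE → ℕ} {M : List LDE → ℕ}
               (M-[] : M [] ≡ 0) (M-∷ : ∀ {x xs} → M (x ∷ xs) ≡ f x ⊔ M xs) where

  f≤M : ∀ {x xs} → x ∈ xs → f x ≤ M xs
  f≤M {x} {.x ∷ xs} (here refl) rewrite M-∷ {x} {xs} = m≤m⊔n (f x) (M xs)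
  f≤M {x} {y ∷ xs} (there x∈) rewrite M-∷ {y} {xs} = ≤-trans (f≤M x∈) (m≤n⊔m (f y) (M xs))

  M-attained : ∀ x xs → ∃[ y ] y ∈ x ∷ xs × M (x ∷ xs) ≡ f y
  M-attained x [] rewrite M-∷ {x} {[]} | M-[] = x , here refl , ⊔-identityʳ (f x)
  M-attained x (y ∷ xs) rewrite M-∷ {x} {y ∷ xs} with ⊔-sel (f x) (M (y ∷ xs))
  ... | inj₁ M≡fx = x , here refl , M≡fx
  ... | inj₂ M≡M′ = let (z , z∈ , M′≡fz) = M-attained y xs in z , there z∈ , trans M≡M′ M′≡fz

module HeightL = Maximum {suc ∘ b} {heightL} refl refl
module MaxFlex = Maximum {flex} {maxFlex} refl refl

b-option< : ∀ G {g} → g ∈ opts G → b g < b G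
b-option< (node gs) = HeightL.f≤M

b-attained : ∀ g gs → ∃[ x ] x ∈ g ∷ gs × b (node (g ∷ gs)) ≡ suc (b x)
b-attained = HeightL.M-attained

b≤ : ∀ {n} G → All (λ g → b g < n) (opts G) → b G ≤ n
b≤ (node []) _ = z≤n
b≤ {n} (node (g ∷ gs)) below =
  let (x , x∈ , b≡) = b-attained g gs in subst (_≤ n) (sym b≡) (All.lookup below x∈)

Integer : LDE → Set
Integer G = isInteger G ≡ true

integer? : ∀ G → Integer G ⊎ isInteger G ≡ false
integer? G with isInteger G
... | true  = inj₁ refl
... | false = inj₂ refl

flex-integer : ∀ G → Integer G → flex G ≡ 0
flex-integer (node gs) int rewrite int = refl

flex-nonInteger : ∀ G → isInteger G ≡ false → flex G ≡ suc (maxFlex (opts G))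
flex-nonInteger (node gs) nonInt rewrite nonInt = refl

flex-option< : ∀ G {g} → isInteger G ≡ false → g ∈ opts G → flex g < flex G
flex-option< G nonInt g∈ rewrite flex-nonInteger G nonInt = s≤s (MaxFlex.f≤M g∈)

flex-attained : ∀ H → isInteger H ≡ false → ∃[ x ] x ∈ opts H × flex H ≡ suc (flex x)
flex-attained (node []) ()
flex-attained H@(node (h ∷ hs)) nonInt rewrite flex-nonInteger H nonInt =
  let (x , x∈ , max≡) = MaxFlex.M-attained h hs in x , x∈ , cong suc max≡

flex≤ : ∀ {n} G → All (λ g → flex g < n) (opts G) → flex G ≤ n
flex≤ {n} G below with integer? G
... | inj₁ int    = ≤-trans (≤-reflexive (flex-integer G int)) z≤n
... | inj₂ nonInt =
  let (x , x∈ , flex≡) = flex-attained G nonInt in subst (_≤ n) (sym flex≡) (All.lookup below x∈)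

iso-sym : ∀ G H → iso G H ≡ iso H G
iso-sym (node gs) (node hs) = ∧-comm (allAny gs hs) (allAny hs gs)

-- The Any half is the other direction of iso: the option bar k of bar (suc k) must be matched.
IsBar : ℕ → LDE → Set
IsBar zero    G = opts G ≡ []
IsBar (suc k) G = All (IsBar k) (opts G) × Any (IsBar k) (opts G)

mutual
  iso-bar⇒IsBar : ∀ k G → iso G (bar k) ≡ true → IsBar k G
  iso-bar⇒IsBar zero    (node [])      _  = refl
  iso-bar⇒IsBar zero    (node (_ ∷ _)) ()
  iso-bar⇒IsBar (suc k) (node gs)      eq =
    allAny-bar⇒All k gs (∧-conicalˡ _ _ eq)
    , anyIso-bar⇒Any k gs (∧-conicalˡ _ true (∧-conicalʳ (allAny gs (bar k ∷ [])) _ eq))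

  allAny-bar⇒All : ∀ k gs → allAny gs (bar k ∷ []) ≡ true → All (IsBar k) gs
  allAny-bar⇒All k []       _  = []
  allAny-bar⇒All k (g ∷ gs) eq with iso g (bar k) in e
  ... | true = iso-bar⇒IsBar k g e ∷ allAny-bar⇒All k gs eq
  allAny-bar⇒All k (g ∷ gs) () | false

  anyIso-bar⇒Any : ∀ k gs → anyIso (bar k) gs ≡ true → Any (IsBar k) gs
  anyIso-bar⇒Any k (g ∷ gs) eq with iso (bar k) g in e
  ... | true  = here (iso-bar⇒IsBar k g (trans (iso-sym g (bar k)) e))
  ... | false = there (anyIso-bar⇒Any k gs eq)

mutual
  IsBar⇒iso-bar : ∀ k G → IsBar k G → iso G (bar k) ≡ true
  IsBar⇒iso-bar zero    (node .[]) refl        = refl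
  IsBar⇒iso-bar (suc k) (node gs)  (all , any)
    rewrite All⇒allAny-bar k gs all | Any⇒anyIso-bar k gs any = refl

  All⇒allAny-bar : ∀ k gs → All (IsBar k) gs → allAny gs (bar k ∷ []) ≡ true
  All⇒allAny-bar k []       []       = refl
  All⇒allAny-bar k (g ∷ gs) (p ∷ ps) rewrite IsBar⇒iso-bar k g p | All⇒allAny-bar k gs ps = refl

  Any⇒anyIso-bar : ∀ k gs → Any (IsBar k) gs → anyIso (bar k) gs ≡ true
  Any⇒anyIso-bar k (g ∷ gs) (here p)   rewrite iso-sym (bar k) g | IsBar⇒iso-bar k g p = refl
  Any⇒anyIso-bar k (g ∷ gs) (there ps) rewrite Any⇒anyIso-bar k gs ps = ∨-zeroʳ _

IsBar⇒b : ∀ k G → IsBar k G → b G ≡ k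
IsBar⇒b zero    (node .[]) refl = refl
IsBar⇒b (suc k) G (all , any) = ≤-antisym
  (b≤ G (All.map (λ {g} p → ≤-reflexive (cong suc (IsBar⇒b k g p))) all))
  (let (x , x∈ , p) = find any in subst (_< b G) (IsBar⇒b k x p) (b-option< G x∈))

IsBar⇒Integer : ∀ k G → IsBar k G → Integer G
IsBar⇒Integer k G p = IsBar⇒iso-bar (b G) G (subst (λ j → IsBar j G) (sym (IsBar⇒b k G p)) p)

IsBar-option : ∀ k G {g} → IsBar k G → g ∈ opts G → Integer g × suc (b g) ≡ k
IsBar-option zero    (node .[]) refl ()
IsBar-option (suc k) G (all , _) g∈ = let p = All.lookup all g∈ in
  IsBar⇒Integer k _ p , cong suc (IsBar⇒b k _ p)

integer⇒option : ∀ G {g} → Integer G → g ∈ opts G → Integer g × suc (b g) ≡ b G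
integer⇒option G int = IsBar-option (b G) G (iso-bar⇒IsBar (b G) G int)

option⇒integer : ∀ G → All (λ g → Integer g × suc (b g) ≡ b G) (opts G) → Integer G
option⇒integer (node [])       _                            = refl
option⇒integer (node (g ∷ gs)) options@(first@(_ , b≡) ∷ _) =
  IsBar⇒Integer (suc (b g)) (node (g ∷ gs)) (All.map isBar options , here (isBar first))
  where
  isBar : ∀ {x} → Integer x × suc (b x) ≡ b (node (g ∷ gs)) → IsBar (b g) x
  isBar (int , b≡′) = subst (λ j → IsBar j _) (suc-injective (trans b≡′ (sym b≡))) (iso-bar⇒IsBar _ _ int)

bar-IsBar : ∀ n → IsBar n (bar n)
bar-IsBar zero    = refl
bar-IsBar (suc n) = bar-IsBar n ∷ [] , here (bar-IsBar n)

b-bar : ∀ n → b (bar n) ≡ n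
b-bar n = IsBar⇒b n (bar n) (bar-IsBar n)

integer-bar : ∀ n → Integer (bar n)
integer-bar n = IsBar⇒Integer n (bar n) (bar-IsBar n)

sumL≡map : ∀ gs H → sumL gs H ≡ map (_+ᴳ H) gs
sumL≡map []       H = refl
sumL≡map (g ∷ gs) H = cong (g +ᴳ H ∷_) (sumL≡map gs H)

sumR≡map : ∀ G hs → sumR G hs ≡ map (G +ᴳ_) hs
sumR≡map G []       = refl
sumR≡map G (h ∷ hs) = cong (G +ᴳ h ∷_) (sumR≡map G hs)

opts-+ : ∀ G H → opts (G +ᴳ H) ≡ map (_+ᴳ H) (opts G) ++ map (G +ᴳ_) (opts H)
opts-+ (node gs) (node hs) = cong₂ _++_ (sumL≡map gs (node hs)) (sumR≡map (node gs) hs)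

All-opts-+ : ∀ {P : LDE → Set} G H →
  All (λ g → P (g +ᴳ H)) (opts G) → All (λ h → P (G +ᴳ h)) (opts H) → All P (opts (G +ᴳ H))
All-opts-+ G H left right =
  subst (All _) (sym (opts-+ G H)) (Allₚ.++⁺ (Allₚ.map⁺ left) (Allₚ.map⁺ right))

∈-opts-+ˡ : ∀ G H {g} → g ∈ opts G → g +ᴳ H ∈ opts (G +ᴳ H)
∈-opts-+ˡ G H g∈ = subst (_ ∈_) (sym (opts-+ G H)) (∈-++⁺ˡ (∈-map⁺ (_+ᴳ H) g∈))

∈-opts-+ʳ : ∀ G H {h} → h ∈ opts H → G +ᴳ h ∈ opts (G +ᴳ H)
∈-opts-+ʳ G H h∈ = subst (_ ∈_) (sym (opts-+ G H)) (∈-++⁺ʳ _ (∈-map⁺ (G +ᴳ_) h∈))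

b-+-≤ : ∀ G H → b (G +ᴳ H) ≤ b G + b H
b-+-≤ = LDE-ind₂ step
  where
  step : IndStep₂ λ G H → b (G +ᴳ H) ≤ b G + b H
  step G H ih-g ih-h = b≤ (G +ᴳ H) (All-opts-+ G H
    (All.tabulate λ g∈ → ≤-<-trans (ih-g g∈) (+-monoˡ-< (b H) (b-option< G g∈)))
    (All.tabulate λ h∈ → ≤-<-trans (ih-h h∈) (+-monoʳ-< (b G) (b-option< H h∈))))

b-+-≥ : ∀ G H → b G + b H ≤ b (G +ᴳ H)
b-+-≥ = LDE-ind₂ step
  where
  step : IndStep₂ λ G H → b G + b H ≤ b (G +ᴳ H)
  step G@(node (g ∷ gs)) H ih-g _ = let (x , x∈ , b≡) = b-attained g gs in
    begin
      b G + b H          ≡⟨ cong (_+ b H) b≡ ⟩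
      suc (b x + b H)    ≤⟨ s≤s (ih-g x∈) ⟩
      suc (b (x +ᴳ H))   ≤⟨ b-option< (G +ᴳ H) (∈-opts-+ˡ G H x∈) ⟩
      b (G +ᴳ H)         ∎
  step G@(node []) H@(node (h ∷ hs)) _ ih-h = let (y , y∈ , b≡) = b-attained h hs in
    begin
      b H                ≡⟨ b≡ ⟩
      suc (b y)          ≤⟨ s≤s (ih-h y∈) ⟩
      suc (b (G +ᴳ y))   ≤⟨ b-option< (G +ᴳ H) (∈-opts-+ʳ G H y∈) ⟩
      b (G +ᴳ H)         ∎
  step (node []) (node []) _ _ = z≤n

b-+ : ∀ G H → b (G +ᴳ H) ≡ b G + b H
b-+ G H = ≤-antisym (b-+-≤ G H) (b-+-≥ G H)

suc-b-+ˡ : ∀ g G H → suc (b (g +ᴳ H)) ≡ b (G +ᴳ H) ⇔ suc (b g) ≡ b G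
suc-b-+ˡ g G H rewrite b-+ g H | b-+ G H = mk⇔ (+-cancelʳ-≡ (b H) _ _) (cong (_+ b H))

suc-b-+ʳ : ∀ G h H → suc (b (G +ᴳ h)) ≡ b (G +ᴳ H) ⇔ suc (b h) ≡ b H
suc-b-+ʳ G h H rewrite b-+ G h | b-+ G H | sym (+-suc (b G) (b h)) =
  mk⇔ (+-cancelˡ-≡ (b G) _ _) (cong (b G +_))

integer-+ : ∀ G H → Integer G → Integer H → Integer (G +ᴳ H)
integer-+ = LDE-ind₂ step
  where
  step : IndStep₂ λ G H → Integer G → Integer H → Integer (G +ᴳ H)
  step G H ih-g ih-h intG intH = option⇒integer (G +ᴳ H) (All-opts-+ G H
    (All.tabulate λ {g} g∈ → let (int , b≡) = integer⇒option G intG g∈ in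
      ih-g g∈ int intH , Equivalence.from (suc-b-+ˡ g G H) b≡)
    (All.tabulate λ {h} h∈ → let (int , b≡) = integer⇒option H intH h∈ in
      ih-h h∈ intG int , Equivalence.from (suc-b-+ʳ G h H) b≡))

integer-+⁻ : ∀ G H → Integer (G +ᴳ H) → Integer G × Integer H
integer-+⁻ = LDE-ind₂ step
  where
  step : IndStep₂ λ G H → Integer (G +ᴳ H) → Integer G × Integer H
  step G H ih-g ih-h int =
      option⇒integer G (All.tabulate λ {g} g∈ →
        let (int′ , b≡) = integer⇒option (G +ᴳ H) int (∈-opts-+ˡ G H g∈) in
        proj₁ (ih-g g∈ int′) , Equivalence.to (suc-b-+ˡ g G H) b≡)
    , option⇒integer H (All.tabulate λ {h} h∈ →
        let (int′ , b≡) = integer⇒option (G +ᴳ H) int (∈-opts-+ʳ G H h∈) in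
        proj₂ (ih-h h∈ int′) , Equivalence.to (suc-b-+ʳ G h H) b≡)

isInteger-+ : ∀ G H → isInteger (G +ᴳ H) ≡ isInteger G ∧ isInteger H
isInteger-+ G H = ⇔→≡ (mk⇔
  (λ int → let (intG , intH) = integer-+⁻ G H int in cong₂ _∧_ intG intH)
  (λ int → integer-+ G H (∧-conicalˡ _ _ int) (∧-conicalʳ _ _ int)))

nonInteger-+ʳ : ∀ G H → isInteger H ≡ false → isInteger (G +ᴳ H) ≡ false
nonInteger-+ʳ G H nonInt rewrite isInteger-+ G H | nonInt = ∧-zeroʳ (isInteger G)

isInteger-+-comm : ∀ G H → isInteger (G +ᴳ H) ≡ isInteger (H +ᴳ G)
isInteger-+-comm G H rewrite isInteger-+ G H | isInteger-+ H G = ∧-comm (isInteger G) (isInteger H)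

flex-+-comm-≤ : ∀ G H → flex (G +ᴳ H) ≤ flex (H +ᴳ G)
flex-+-comm-≤ = LDE-ind₂ step
  where
  step : IndStep₂ λ G H → flex (G +ᴳ H) ≤ flex (H +ᴳ G)
  step G H ih-g ih-h with integer? (H +ᴳ G)
  ... | inj₁ int =
    ≤-trans (≤-reflexive (flex-integer (G +ᴳ H) (trans (isInteger-+-comm G H) int))) z≤n
  ... | inj₂ nonInt = flex≤ (G +ᴳ H) (All-opts-+ G H
    (All.tabulate λ g∈ → ≤-<-trans (ih-g g∈) (flex-option< (H +ᴳ G) nonInt (∈-opts-+ʳ H G g∈)))
    (All.tabulate λ h∈ → ≤-<-trans (ih-h h∈) (flex-option< (H +ᴳ G) nonInt (∈-opts-+ˡ H G h∈))))

flex-+-comm : ∀ G H → flex (G +ᴳ H) ≡ flex (H +ᴳ G)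
flex-+-comm G H = ≤-antisym (flex-+-comm-≤ G H) (flex-+-comm-≤ H G)

flex-+-integer-≤ : ∀ G I → isInteger G ≡ false → Integer I → flex (G +ᴳ I) ≤ flex G + b I
flex-+-integer-≤ = LDE-ind₂ step
  where
  step : IndStep₂ λ G I → isInteger G ≡ false → Integer I → flex (G +ᴳ I) ≤ flex G + b I
  step G I ih-g ih-i nonInt int = flex≤ (G +ᴳ I) (All-opts-+ G I
    (All.tabulate λ g∈ → ≤-<-trans (bound g∈) (+-monoˡ-< (b I) (flex-option< G nonInt g∈)))
    (All.tabulate λ i∈ → ≤-<-trans (ih-i i∈ nonInt (proj₁ (integer⇒option I int i∈)))
                                   (+-monoʳ-< (flex G) (b-option< I i∈))))
    where
    bound : ∀ {g} → g ∈ opts G → flex (g +ᴳ I) ≤ flex g + b I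
    bound {g} g∈ with integer? g
    ... | inj₁ intg    = ≤-trans (≤-reflexive (flex-integer (g +ᴳ I) (integer-+ g I intg int))) z≤n
    ... | inj₂ nonIntg = ih-g g∈ nonIntg int

integer-+-flex-≤ : ∀ I H → Integer I → isInteger H ≡ false → flex (I +ᴳ H) ≤ b I + flex H
integer-+-flex-≤ I H int nonInt = begin
  flex (I +ᴳ H)  ≡⟨ flex-+-comm I H ⟩
  flex (H +ᴳ I)  ≤⟨ flex-+-integer-≤ H I nonInt int ⟩
  flex H + b I   ≡⟨ +-comm (flex H) (b I) ⟩
  b I + flex H   ∎

b+flex≤flex-+ : ∀ G H → isInteger H ≡ false → b G + flex H ≤ flex (G +ᴳ H)
b+flex≤flex-+ = LDE-ind₂ step
  where
  step : IndStep₂ λ G H → isInteger H ≡ false → b G + flex H ≤ flex (G +ᴳ H)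
  step G@(node (g ∷ gs)) H ih-g _ nonInt = let (x , x∈ , b≡) = b-attained g gs in
    begin
      b G + flex H         ≡⟨ cong (_+ flex H) b≡ ⟩
      suc (b x + flex H)   ≤⟨ s≤s (ih-g x∈ nonInt) ⟩
      suc (flex (x +ᴳ H))  ≤⟨ flex-option< (G +ᴳ H) (nonInteger-+ʳ G H nonInt) (∈-opts-+ˡ G H x∈) ⟩
      flex (G +ᴳ H)        ∎
  step G@(node []) H _ ih-h nonInt = let (y , y∈ , flex≡) = flex-attained H nonInt in
    begin
      flex H               ≡⟨ flex≡ ⟩
      suc (flex y)         ≤⟨ s≤s (bound y∈) ⟩
      suc (flex (G +ᴳ y))  ≤⟨ flex-option< (G +ᴳ H) (nonInteger-+ʳ G H nonInt) (∈-opts-+ʳ G H y∈) ⟩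
      flex (G +ᴳ H)        ∎
    where
    bound : ∀ {h} → h ∈ opts H → flex h ≤ flex (G +ᴳ h)
    bound {h} h∈ with integer? h
    ... | inj₁ inth    = ≤-trans (≤-reflexive (flex-integer h inth)) z≤n
    ... | inj₂ nonInth = ih-h h∈ nonInth

flex+b≤flex-+ : ∀ G H → isInteger G ≡ false → flex G + b H ≤ flex (G +ᴳ H)
flex+b≤flex-+ G H nonInt = begin
  flex G + b H   ≡⟨ +-comm (flex G) (b H) ⟩
  b H + flex G   ≤⟨ b+flex≤flex-+ H G nonInt ⟩
  flex (H +ᴳ G)  ≡⟨ flex-+-comm H G ⟩
  flex (G +ᴳ H)  ∎

flex-+-≤ : ∀ G H → isInteger G ≡ false → isInteger H ≡ false →
  flex (G +ᴳ H) ≤ (b G + flex H) ⊔ (flex G + b H)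
flex-+-≤ = LDE-ind₂ step
  where
  step : IndStep₂ λ G H → isInteger G ≡ false → isInteger H ≡ false →
    flex (G +ᴳ H) ≤ (b G + flex H) ⊔ (flex G + b H)
  step G H ih-g ih-h nonIntG nonIntH = flex≤ (G +ᴳ H) (All-opts-+ G H
    (All.tabulate λ g∈ → ≤-<-trans (bound-g g∈)
      (⊔-mono-< (+-monoˡ-< (flex H) (b-option< G g∈)) (+-monoˡ-< (b H) (flex-option< G nonIntG g∈))))
    (All.tabulate λ h∈ → ≤-<-trans (bound-h h∈)
      (⊔-mono-< (+-monoʳ-< (b G) (flex-option< H nonIntH h∈)) (+-monoʳ-< (flex G) (b-option< H h∈)))))
    where
    bound-g : ∀ {g} → g ∈ opts G → flex (g +ᴳ H) ≤ (b g + flex H) ⊔ (flex g + b H)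
    bound-g {g} g∈ with integer? g
    ... | inj₁ intg    = ≤-trans (integer-+-flex-≤ g H intg nonIntH) (m≤m⊔n _ _)
    ... | inj₂ nonIntg = ih-g g∈ nonIntg nonIntH

    bound-h : ∀ {h} → h ∈ opts H → flex (G +ᴳ h) ≤ (b G + flex h) ⊔ (flex G + b h)
    bound-h {h} h∈ with integer? h
    ... | inj₁ inth    = ≤-trans (flex-+-integer-≤ G h nonIntG inth) (m≤n⊔m _ _)
    ... | inj₂ nonInth = ih-h h∈ nonIntG nonInth

flex-+-integer : ∀ G I → isInteger G ≡ false → Integer I → flex (G +ᴳ I) ≡ flex G + b I
flex-+-integer G I nonInt int = ≤-antisym (flex-+-integer-≤ G I nonInt int) (flex+b≤flex-+ G I nonInt)

flex-+ : ∀ G H → isInteger G ≡ false → isInteger H ≡ false →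
  flex (G +ᴳ H) ≡ (b G + flex H) ⊔ (flex G + b H)
flex-+ G H nonIntG nonIntH = ≤-antisym (flex-+-≤ G H nonIntG nonIntH)
  (⊔-lub (b+flex≤flex-+ G H nonIntH) (flex+b≤flex-+ G H nonIntG))

mainTheorem11 : (G H : LDE) → isInteger G ≡ false → isInteger H ≡ false →
    ((n : ℕ) → flex (G +ᴳ bar n) ≡ flex G + n)
    × (flex (G +ᴳ H) ≡ (b G + flex H) ⊔ (flex G + b H))
mainTheorem11 G H nonIntG nonIntH =
    (λ n → trans (flex-+-integer G (bar n) nonIntG (integer-bar n)) (cong (flex G +_) (b-bar n)))
  , flex-+ G H nonIntG nonIntH
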